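{- Let $c$ and $q$ be positive integers and let $G$ be a $\mu$-bounded graph with parameter $c$. If the associated Hoffman graph $\mathfrak{g}(G,q)$ is a $2$-fat $\{\mathfrak{h}^{(3)},\mathfrak{d}\}$-line Hoffman graph, then there exists a $(0,\pm1)$-matrix $N$ whose columns $N_v$ are indexed by $V(G)$ such that: (i) $A(G)+3I=N^TN$ and $\lambda_{\min}(G)\geq -3$; (ii) $N_v^TN_v=3$ and $\mathbf{j}^TN_v\in\{1,3\}$ for every $v\in V(G)$; (iii) if $\mathbf{j}^TN_v=1$, then there is a vertex $u\in V(G)$ with $N_v^TN_u=1$ and $\operatorname{supp}(N_v)=\operatorname{supp}(N_u)$.
   Context: $A(G)$ is the adjacency matrix, $\mathbf{j}$ the all-ones vector, $\operatorname{supp}(\mathbf{v})$ the set of indices of nonzero entries. $G$ is $\mu$-bounded with parameter $c$ if any two distinct non-adjacent vertices have at most $c$ common neighbours. A Hoffman graph $\mathfrak{h}=(H,\ell)$ is a graph $H$ with vertices labelled fat or slim, no two fat vertices adjacent, every fat vertex with a slim neighbour; it is $t$-fat if every slim vertex has at least $t$ fat neighbours. Special matrix: $S(\mathfrak{h})=A_{\rm slim}-M^TM$, with $A_{\rm slim}$ the adjacency matrix of the slim graph (subgraph induced on slim vertices) and $M$ the fat-by-slim $0/1$ adjacency matrix. Induced Hoffman subgraphs are induced subgraphs with inherited labels; the one generated by a set $W$ of slim vertices is induced on $W$ plus all fat vertices adjacent to a vertex of $W$. A decomposition of $\mathfrak{h}$ is a family $\{\mathfrak{h}^i\}$ generated by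 the parts of a partition of the slim vertices such that $S(\mathfrak{h})$ is block diagonal w.r.t. that partition. For a family $\mathfrak{G}$, $\mathfrak{h}$ is a $\mathfrak{G}$-line Hoffman graph if some Hoffman graph $\mathfrak{h}'$ with the same slim graph contains $\mathfrak{h}$ as induced Hoffman subgraph and has a decomposition whose members are each isomorphic to an induced Hoffman subgraph of a member of $\mathfrak{G}$. $\mathfrak{h}^{(3)}$: one slim vertex adjacent to three fat vertices; $\mathfrak{d}$: two adjacent slim vertices and two fat vertices, each fat adjacent to both slim vertices. The associated Hoffman graph $\mathfrak{g}(G,q)$ has slim graph $G$ and one fat vertex for each maximal clique of $G$ of order at least $q$, adjacent exactly to the vertices of that clique. -}

module Defs where

open import Data.Bool using (Bool; true; false; _∧_; _∨_; if_then_else_; T; not)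
open import Data.Nat as ℕ using (ℕ; zero; suc; _≤_)
open import Data.Fin using (Fin; zero; suc)
open import Data.Fin.Properties using () renaming (_≟_ to _≟ᶠ_)
open import Data.Integer as ℤ using (ℤ)
open import Data.Rational as ℚ using (ℚ)
open import Data.Product using (Σ; ∃; _×_; _,_)
open import Data.Sum using (_⊎_)
open import Relation.Nullary using (¬_; ⌊_⌋)
open import Relation.Binary.PropositionalEquality using (_≡_; _≢_)

count : ∀ {n} → (Fin n → Bool) → ℕ
count {zero}  p = 0
count {suc n} p = (if p zero then 1 else 0) ℕ.+ count (λ i → p (suc i))

anyB : ∀ {n} → (Fin n → Bool) → Bool
anyB {zero}  p = false
anyB {suc n} p = p zero ∨ anyB (λ i → p (suc i))

sumℤ : ∀ {n} → (Fin n → ℤ) → ℤ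
sumℤ {zero}  f = ℤ.0ℤ
sumℤ {suc n} f = f zero ℤ.+ sumℤ (λ i → f (suc i))

sumℚ : ∀ {n} → (Fin n → ℚ) → ℚ
sumℚ {zero}  f = ℚ.0ℚ
sumℚ {suc n} f = f zero ℚ.+ sumℚ (λ i → f (suc i))

record Graph (n : ℕ) : Set where
  field
    adj   : Fin n → Fin n → Bool
    sym   : ∀ x y → adj x y ≡ adj y x
    irrefl : ∀ x → adj x x ≡ false
open Graph public

A : ∀ {n} → Graph n → Fin n → Fin n → ℤ
A G x y = if adj G x y then ℤ.1ℤ else ℤ.0ℤ

δ : ∀ {n} → Fin n → Fin n → ℤ
δ x y = if ⌊ x ≟ᶠ y ⌋ then ℤ.1ℤ else ℤ.0ℤ

MuBounded : ∀ {n} → Graph n → ℕ → Set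
MuBounded G c = ∀ x y → x ≢ y → adj G x y ≡ false →
  count (λ z → adj G x z ∧ adj G y z) ≤ c

IsClique : ∀ {n} → Graph n → (Fin n → Bool) → Set
IsClique G C = ∀ x y → C x ≡ true → C y ≡ true → x ≢ y → adj G x y ≡ true

IsMaximalClique : ∀ {n} → Graph n → (Fin n → Bool) → Set
IsMaximalClique G C = IsClique G C ×
  (∀ D → IsClique G D → (∀ x → C x ≡ true → D x ≡ true) → ∀ x → D x ≡ true → C x ≡ true)

-- Hoffman graphs with slim vertices Fin s and fat vertices Fin fat.
-- Fat vertices are pairwise non-adjacent by construction; inc F x says
-- fat vertex F is adjacent to slim vertex x.

record Hoffman (s : ℕ) : Set where
  field
    slim  : Graph s
    fat   : ℕ
    inc   : Fin fat → Fin s → Bool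
    fatOK : ∀ F → ∃ λ x → inc F x ≡ true
open Hoffman public

-- special matrix S(h) = A_slim - M^T M
S : ∀ {s} → (h : Hoffman s) → Fin s → Fin s → ℤ
S h x y = A (slim h) x y ℤ.- ℤ.+ (count (λ F → inc h F x ∧ inc h F y))

IsFat : ∀ {s} → ℕ → Hoffman s → Set
IsFat t h = ∀ x → t ≤ count (λ F → inc h F x)

-- The Hoffman subgraph of h generated by the slim vertex set W is isomorphic
-- to an induced Hoffman subgraph of g: injective maps on slim and fat vertices
-- of the generated subgraph preserving and reflecting all adjacencies.
genFat : ∀ {s} → (h : Hoffman s) → (Fin s → Bool) → Fin (fat h) → Bool
genFat h W F = anyB (λ x → W x ∧ inc h F x)

record GenEmb {s t : ℕ} (h : Hoffman s) (W : Fin s → Bool) (g : Hoffman t) : Set where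
  field
    σ : (x : Fin s) → T (W x) → Fin t
    τ : (F : Fin (fat h)) → T (genFat h W F) → Fin (fat g)
    σ-inj : ∀ x y (wx : T (W x)) (wy : T (W y)) → σ x wx ≡ σ y wy → x ≡ y
    τ-inj : ∀ F G (gF : T (genFat h W F)) (gG : T (genFat h W G)) → τ F gF ≡ τ G gG → F ≡ G
    adj-pres : ∀ x y (wx : T (W x)) (wy : T (W y)) →
      adj (slim h) x y ≡ adj (slim g) (σ x wx) (σ y wy)
    inc-pres : ∀ F x (gF : T (genFat h W F)) (wx : T (W x)) →
      inc h F x ≡ inc g (τ F gF) (σ x wx)

-- h is isomorphic to an induced Hoffman subgraph of g
-- (the subgraph generated by all slim vertices is h itself)
InducedIn : ∀ {s t} → Hoffman s → Hoffman t → Set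
InducedIn h g = GenEmb h (λ _ → true) g

-- A Hoffman graph h' with the same slim graph as h containing h as induced
-- Hoffman subgraph: the fat vertices of h are (injectively) among those of h'.
record Extension {s : ℕ} (h : Hoffman s) : Set where
  field
    fat'   : ℕ
    inc'   : Fin fat' → Fin s → Bool
    fatOK' : ∀ F → ∃ λ x → inc' F x ≡ true
    emb    : Fin (fat h) → Fin fat'
    emb-inj : ∀ F G → emb F ≡ emb G → F ≡ G
    emb-inc : ∀ F x → inc' (emb F) x ≡ inc h F x

  hoff : Hoffman s
  hoff = record { slim = slim h ; fat = fat' ; inc = inc' ; fatOK = fatOK' }

-- A decomposition of h given by a partition p of the slim vertices into
-- k parts (part i = { x | p x = i }): S(h) is block diagonal.
IsDecomposition : ∀ {s k} → Hoffman s → (Fin s → Fin k) → Set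
IsDecomposition h p = ∀ x y → p x ≢ p y → S h x y ≡ ℤ.0ℤ

part : ∀ {s k} → (Fin s → Fin k) → Fin k → Fin s → Bool
part p i x = ⌊ p x ≟ᶠ i ⌋

IsLine : (𝔊 : (t : ℕ) → Hoffman t → Set) → ∀ {s} → Hoffman s → Set
IsLine 𝔊 {s} h = Σ (Extension h) λ E → Σ ℕ λ k → Σ (Fin s → Fin k) λ p →
  IsDecomposition (Extension.hoff E) p ×
  (∀ i → Σ ℕ λ t → Σ (Hoffman t) λ g → 𝔊 t g × GenEmb (Extension.hoff E) (part p i) g)

h3 : Hoffman 1
h3 = record
  { slim = record { adj = λ _ _ → false ; sym = λ _ _ → _≡_.refl ; irrefl = λ _ → _≡_.refl }
  ; fat = 3 ; inc = λ _ _ → true ; fatOK = λ F → zero , _≡_.refl }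

dAdj : Fin 2 → Fin 2 → Bool
dAdj x y = not ⌊ x ≟ᶠ y ⌋

dSym : ∀ x y → dAdj x y ≡ dAdj y x
dSym zero zero = _≡_.refl
dSym zero (suc zero) = _≡_.refl
dSym (suc zero) zero = _≡_.refl
dSym (suc zero) (suc zero) = _≡_.refl

dIrr : ∀ x → dAdj x x ≡ false
dIrr zero = _≡_.refl
dIrr (suc zero) = _≡_.refl

𝔡 : Hoffman 2
𝔡 = record
  { slim = record { adj = dAdj ; sym = dSym ; irrefl = dIrr }
  ; fat = 2 ; inc = λ _ _ → true ; fatOK = λ F → zero , _≡_.refl }

-- the family {h^(3), 𝔡} (membership up to isomorphism)
H3D : (t : ℕ) → Hoffman t → Set
H3D t g = (InducedIn g h3 × InducedIn h3 g) ⊎ (InducedIn g 𝔡 × InducedIn 𝔡 g)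

-- h is (isomorphic to) the associated Hoffman graph 𝔤(G,q): slim graph G,
-- fat vertices in bijection with the maximal cliques of order ≥ q, each
-- adjacent exactly to the vertices of its clique.
IsAssociated : ∀ {n} → Graph n → ℕ → Hoffman n → Set
IsAssociated {n} G q h =
  (∀ x y → adj (slim h) x y ≡ adj G x y) ×
  (∀ F → IsMaximalClique G (inc h F) × q ≤ count (inc h F)) ×
  (∀ F F' → (∀ x → inc h F x ≡ inc h F' x) → F ≡ F') ×
  (∀ C → IsMaximalClique G C → q ≤ count C → ∃ λ F → ∀ x → inc h F x ≡ C x)

-- Let 𝔥′ ⊇ 𝔥 be the Hoffman graph carrying the decomposition into induced subgraphs of 𝔥⁽³⁾ and 𝔡.
-- Each slim vertex has 2 or 3 fat neighbours in 𝔥′ (at least 2 by 2-fatness, at most as many as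
-- its model), and a part with two slim vertices is an edge whose ends share the same two fat
-- neighbours. Take as rows of N the incidence vectors of the fat vertices of 𝔥′, plus one row per
-- part, with entry 0 at a vertex with 3 fat neighbours and ±1 at the others, the two ends of a
-- 𝔡-part getting opposite signs. Then NᵀN = A + 3I: on the diagonal 3 + 0 = 2 + 1, inside a
-- 𝔡-part 2 − 1 = 1, and across parts NᵀN agrees with A because S(𝔥′) is block diagonal.
-- Being a Gram matrix, A + 3I is positive semidefinite.
module Submission where

open import Algebra.Bundles using (CommutativeSemiring; CommutativeRing)
open import Data.Bool using (Bool; true; false; T; _∧_; if_then_else_)
open import Data.Bool.Properties using (T-≡; T-∧; T-∨; ∧-idem)
open import Data.Fin using (Fin; zero; suc; _<_; splitAt)
open import Data.Fin.Properties using (suc-injective; any?; _<?_; <-cmp; <⇒≢; <-trans)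
  renaming (_≟_ to _≟ᶠ_)
open import Data.Integer as ℤ using (ℤ; 0ℤ; 1ℤ; -1ℤ; +_)
import Data.Integer.Properties as ℤᴾ
open import Data.Nat as ℕ using (ℕ; zero; suc; _≤_; z≤n; s≤s)
import Data.Nat.Properties as ℕᴾ
open import Data.Product using (Σ; ∃; _×_; _,_; proj₁)
open import Data.Rational as ℚ using (ℚ; 0ℚ)
import Data.Rational.Properties as ℚᴾ
open import Data.Rational.Literals using (fromℤ)
open import Data.Sum using (_⊎_; inj₁; inj₂)
open import Data.Unit using (tt)
open import Data.Vec.Functional using (_++_)
open import Data.Vec.Functional.Relation.Unary.All.Properties using (++⁺)
open import Function using (_∘_; id; _⇔_; mk⇔; Equivalence)
open import Relation.Binary using (tri<; tri≈; tri>)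
open import Relation.Binary.PropositionalEquality
  using (_≡_; _≢_; refl; sym; trans; cong; cong₂; subst; module ≡-Reasoning)
open import Relation.Nullary using (¬_; Dec; yes; no; ⌊_⌋; contradiction; _×-dec_)
open import Relation.Nullary.Decidable using (fromWitness)

open import Defs hiding (sym)

open Equivalence using (to; from)

module GramMatrix {c ℓ} (R : CommutativeSemiring c ℓ) where

  open CommutativeSemiring R renaming (refl to ≈-refl; sym to ≈-sym; trans to ≈-trans)
  open import Algebra.Properties.Semiring.Sum semiring
    using (sum; sum-syntax; ∑-comm; sum-cong-≋; *-distribˡ-sum; *-distribʳ-sum)
  open import Algebra.Solver.CommutativeMonoid *-commutativeMonoid using (solve; _⊕_; _⊜_)
  open import Relation.Binary.Reasoning.Setoid setoid

  gram-quadraticForm : ∀ {m n} (N : Fin m → Fin n → Carrier) (x : Fin n → Carrier) →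
    ∑[ u < n ] ∑[ v < n ] (x u * (∑[ i < m ] (N i u * N i v) * x v))
      ≈ ∑[ i < m ] (∑[ u < n ] (N i u * x u) * ∑[ v < n ] (N i v * x v))
  gram-quadraticForm {m} {n} N x = begin
    ∑[ u < n ] ∑[ v < n ] (x u * (∑[ i < m ] (N i u * N i v) * x v))
      ≈⟨ sum-cong-≋ (λ u → sum-cong-≋ (λ v → expand u v)) ⟩
    ∑[ u < n ] ∑[ v < n ] ∑[ i < m ] (N i u * x u * (N i v * x v))
      ≈⟨ sum-cong-≋ (λ u → ∑-comm (λ v i → N i u * x u * (N i v * x v))) ⟩
    ∑[ u < n ] ∑[ i < m ] ∑[ v < n ] (N i u * x u * (N i v * x v))
      ≈⟨ ∑-comm (λ u i → ∑[ v < n ] (N i u * x u * (N i v * x v))) ⟩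
    ∑[ i < m ] ∑[ u < n ] ∑[ v < n ] (N i u * x u * (N i v * x v))
      ≈⟨ sum-cong-≋ (λ i → sum-cong-≋ (λ u → ≈-sym (*-distribˡ-sum (N i u * x u) (λ v → N i v * x v)))) ⟩
    ∑[ i < m ] ∑[ u < n ] (N i u * x u * ∑[ v < n ] (N i v * x v))
      ≈⟨ sum-cong-≋ (λ i → ≈-sym (*-distribʳ-sum (∑[ v < n ] (N i v * x v)) (λ u → N i u * x u))) ⟩
    ∑[ i < m ] (∑[ u < n ] (N i u * x u) * ∑[ v < n ] (N i v * x v)) ∎
    where
    expand : ∀ u v → x u * (∑[ i < m ] (N i u * N i v) * x v) ≈ ∑[ i < m ] (N i u * x u * (N i v * x v))
    expand u v = begin
      x u * (∑[ i < m ] (N i u * N i v) * x v)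
        ≈⟨ *-congˡ (*-distribʳ-sum (x v) (λ i → N i u * N i v)) ⟩
      x u * ∑[ i < m ] (N i u * N i v * x v)
        ≈⟨ *-distribˡ-sum (x u) (λ i → N i u * N i v * x v) ⟩
      ∑[ i < m ] (x u * (N i u * N i v * x v))
        ≈⟨ sum-cong-≋ (λ i → solve 4 (λ a b c d → a ⊕ ((b ⊕ c) ⊕ d) ⊜ (b ⊕ a) ⊕ (c ⊕ d)) ≈-refl (x u) (N i u) (N i v) (x v)) ⟩
      ∑[ i < m ] (N i u * x u * (N i v * x v)) ∎

open GramMatrix using (gram-quadraticForm)

module RationalGram where

  open import Data.Rational using (_+_; _*_; _/_)
  open import Algebra.Properties.Semiring.Sum (CommutativeRing.semiring ℚᴾ.+-*-commutativeRing)
    using (sum; sum-cong-≗)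
  open ≡-Reasoning

  fromℤ-+ : ∀ a b → fromℤ (a ℤ.+ b) ≡ fromℤ a + fromℤ b
  fromℤ-+ a b = begin
    fromℤ (a ℤ.+ b)                  ≡⟨ sym (ℚᴾ.↥p/↧p≡p (fromℤ (a ℤ.+ b))) ⟩
    (a ℤ.+ b) / 1                    ≡⟨ cong (_/ 1) (sym (cong₂ ℤ._+_ (ℤᴾ.*-identityʳ a) (ℤᴾ.*-identityʳ b))) ⟩
    (a ℤ.* 1ℤ ℤ.+ b ℤ.* 1ℤ) / 1      ≡⟨⟩
    fromℤ a + fromℤ b                ∎

  fromℤ-* : ∀ a b → fromℤ (a ℤ.* b) ≡ fromℤ a * fromℤ b
  fromℤ-* a b = sym (ℚᴾ.↥p/↧p≡p (fromℤ (a ℤ.* b)))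

  fromℤ-sumℤ : ∀ {m} (f : Fin m → ℤ) → fromℤ (sumℤ f) ≡ sum (fromℤ ∘ f)
  fromℤ-sumℤ {zero}  f = refl
  fromℤ-sumℤ {suc m} f = trans (fromℤ-+ (f zero) _) (cong (λ s → fromℤ (f zero) + s) (fromℤ-sumℤ (f ∘ suc)))

  sumℚ≡sum : ∀ {m} (f : Fin m → ℚ) → sumℚ f ≡ sum f
  sumℚ≡sum {zero}  f = refl
  sumℚ≡sum {suc m} f = cong (λ s → f zero + s) (sumℚ≡sum (f ∘ suc))

  square-nonNegative : ∀ p → 0ℚ ℚ.≤ p * p
  square-nonNegative p with ℚᴾ.≤-total 0ℚ p
  ... | inj₁ 0≤p = ℚᴾ.nonNegative⁻¹ _ {{ℚᴾ.nonNeg*nonNeg⇒nonNeg p {{ℚ.nonNegative 0≤p}} p {{ℚ.nonNegative 0≤p}}}}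
  ... | inj₂ p≤0 = ℚᴾ.nonNegative⁻¹ _ {{ℚᴾ.nonPos*nonPos⇒nonPos p {{ℚ.nonPositive p≤0}} p {{ℚ.nonPositive p≤0}}}}

  sum-nonNegative : ∀ {m} (f : Fin m → ℚ) → (∀ i → 0ℚ ℚ.≤ f i) → 0ℚ ℚ.≤ sum f
  sum-nonNegative {zero}  f f≥0 = ℚᴾ.≤-refl
  sum-nonNegative {suc m} f f≥0 = ℚᴾ.+-mono-≤ (f≥0 zero) (sum-nonNegative (f ∘ suc) (f≥0 ∘ suc))

  gram⇒positiveSemidefinite : ∀ {m n} (N : Fin m → Fin n → ℤ) (M : Fin n → Fin n → ℤ) →
    (∀ u v → M u v ≡ sumℤ (λ i → N i u ℤ.* N i v)) →
    ∀ (x : Fin n → ℚ) → 0ℚ ℚ.≤ sumℚ (λ u → sumℚ (λ v → x u * (M u v / 1 * x v)))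
  gram⇒positiveSemidefinite {m} {n} N M M≡NᵀN x =
    subst (0ℚ ℚ.≤_) (sym quadraticForm) (sum-nonNegative _ (λ i → square-nonNegative (y i)))
    where
    Nℚ : Fin m → Fin n → ℚ
    Nℚ i u = fromℤ (N i u)
    y : Fin m → ℚ
    y i = sum (λ u → Nℚ i u * x u)
    entry : ∀ u v → M u v / 1 ≡ sum (λ i → Nℚ i u * Nℚ i v)
    entry u v = begin
      M u v / 1                            ≡⟨ cong (_/ 1) (M≡NᵀN u v) ⟩
      sumℤ (λ i → N i u ℤ.* N i v) / 1     ≡⟨ ℚᴾ.↥p/↧p≡p (fromℤ (sumℤ (λ i → N i u ℤ.* N i v))) ⟩
      fromℤ (sumℤ (λ i → N i u ℤ.* N i v)) ≡⟨ fromℤ-sumℤ (λ i → N i u ℤ.* N i v) ⟩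
      sum (λ i → fromℤ (N i u ℤ.* N i v))  ≡⟨ sum-cong-≗ (λ i → fromℤ-* (N i u) (N i v)) ⟩
      sum (λ i → Nℚ i u * Nℚ i v)          ∎
    form : Fin n → Fin n → ℚ
    form u v = x u * (M u v / 1 * x v)
    quadraticForm : sumℚ (λ u → sumℚ (form u)) ≡ sum (λ i → y i * y i)
    quadraticForm = begin
      sumℚ (λ u → sumℚ (form u))
        ≡⟨ sumℚ≡sum (λ u → sumℚ (form u)) ⟩
      sum (λ u → sumℚ (form u))
        ≡⟨ sum-cong-≗ (λ u → trans (sumℚ≡sum (form u)) (sum-cong-≗ (λ v → cong (λ e → x u * (e * x v)) (entry u v)))) ⟩
      sum (λ u → sum (λ v → x u * (sum (λ i → Nℚ i u * Nℚ i v) * x v)))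
        ≡⟨ gram-quadraticForm (CommutativeRing.commutativeSemiring ℚᴾ.+-*-commutativeRing) Nℚ x ⟩
      sum (λ i → y i * y i) ∎

open RationalGram using (gram⇒positiveSemidefinite)

T-anyB : ∀ {a} {P : Fin a → Bool} → T (anyB P) ⇔ (∃ λ i → T (P i))
T-anyB = mk⇔ witness (λ (i , tᵢ) → intro i tᵢ)
  where
  witness : ∀ {a} {P : Fin a → Bool} → T (anyB P) → ∃ λ i → T (P i)
  witness {suc a} t with to T-∨ t
  ... | inj₁ t₀ = zero , t₀
  ... | inj₂ t₁ with witness t₁
  ...   | i , tᵢ = suc i , tᵢ
  intro : ∀ {a} {P : Fin a → Bool} i → T (P i) → T (anyB P)
  intro zero    tᵢ = from T-∨ (inj₁ tᵢ)
  intro (suc i) tᵢ = from T-∨ (inj₂ (intro i tᵢ))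

T-injective : ∀ {a b} → (T a → T b) → (T b → T a) → a ≡ b
T-injective {false} {false} _ _ = refl
T-injective {false} {true}  _ b⇒a = contradiction (b⇒a tt) λ ()
T-injective {true}          a⇒b _ = sym (to T-≡ (a⇒b tt))

count-cong : ∀ {a} {P Q : Fin a → Bool} → (∀ i → P i ≡ Q i) → count P ≡ count Q
count-cong {zero}  P≡Q = refl
count-cong {suc a} P≡Q = cong₂ ℕ._+_ (cong (λ b → if b then 1 else 0) (P≡Q zero)) (count-cong (P≡Q ∘ suc))

count-true : ∀ a → count {a} (λ _ → true) ≡ a
count-true zero    = refl
count-true (suc a) = cong suc (count-true a)

remove : ∀ {b} → (Fin b → Bool) → Fin b → Fin b → Bool
remove Q j y = if ⌊ y ≟ᶠ j ⌋ then false else Q y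

remove-suc : ∀ {b} (Q : Fin (suc b) → Bool) j i → remove Q (suc j) (suc i) ≡ remove (Q ∘ suc) j i
remove-suc Q j i with i ≟ᶠ j
... | yes refl = refl
... | no _     = refl

T-remove : ∀ {b} {Q : Fin b → Bool} {j y} → T (Q y) → y ≢ j → T (remove Q j y)
T-remove {j = j} {y} qy y≢j with y ≟ᶠ j
... | yes y≡j = contradiction y≡j y≢j
... | no _    = qy

count-remove : ∀ {b} (Q : Fin b → Bool) j → T (Q j) → count Q ≡ suc (count (remove Q j))
count-remove Q zero    qj with Q zero
... | true = refl
count-remove Q (suc j) qj with Q zero
... | true  = cong suc (trans (count-remove (Q ∘ suc) j qj) (cong suc (count-cong (sym ∘ remove-suc Q j))))
... | false = trans (count-remove (Q ∘ suc) j qj) (cong suc (count-cong (sym ∘ remove-suc Q j)))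

count-mono-injection : ∀ {a b} (P : Fin a → Bool) (Q : Fin b → Bool) (f : ∀ i → T (P i) → Fin b) →
  (∀ i p → T (Q (f i p))) → (∀ i j p q → f i p ≡ f j q → i ≡ j) → count P ≤ count Q
count-mono-injection {zero} P Q f f∈Q f-inj = z≤n
count-mono-injection {suc a} P Q f f∈Q f-inj = step
  where
  tail-inj : ∀ i j p q → f (suc i) p ≡ f (suc j) q → i ≡ j
  tail-inj i j p q e = suc-injective (f-inj (suc i) (suc j) p q e)
  step : count P ≤ count Q
  step with P zero in P₀
  ... | false = count-mono-injection (P ∘ suc) Q (f ∘ suc) (f∈Q ∘ suc) tail-inj
  ... | true  = subst (suc (count (P ∘ suc)) ≤_) (sym (count-remove Q j₀ (f∈Q zero p₀)))
                  (s≤s (count-mono-injection (P ∘ suc) (remove Q j₀) (f ∘ suc) avoids-j₀ tail-inj))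
    where
    p₀ : T (P zero)
    p₀ = from T-≡ P₀
    j₀ = f zero p₀
    avoids-j₀ : ∀ i p → T (remove Q j₀ (f (suc i) p))
    avoids-j₀ i p = T-remove {Q = Q} (f∈Q (suc i) p) (λ e → contradiction (f-inj (suc i) zero p p₀ e) λ ())

fatDegree : ∀ {s} → Hoffman s → Fin s → ℕ
fatDegree h x = count (λ F → inc h F x)

commonFat : ∀ {s} → Hoffman s → Fin s → Fin s → ℕ
commonFat h x y = count (λ F → inc h F x ∧ inc h F y)

fatDegree-≤-extension : ∀ {s} {h : Hoffman s} (E : Extension h) x → fatDegree h x ≤ fatDegree (Extension.hoff E) x
fatDegree-≤-extension E x = count-mono-injection _ _ (λ F _ → emb F)
  (λ F p → subst T (sym (emb-inc F x)) p) (λ F F' _ _ → emb-inj F F')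
  where open Extension E

GenEmb-∘ : ∀ {s t u} {h : Hoffman s} {W} {g : Hoffman t} {m : Hoffman u} →
  GenEmb h W g → InducedIn g m → GenEmb h W m
GenEmb-∘ {h = h} {W} {g} e f = record
  { σ        = λ x wx → f.σ (e.σ x wx) tt
  ; τ        = λ F gF → f.τ (e.τ F gF) (τ-generated F gF)
  ; σ-inj    = λ x y wx wy eq → e.σ-inj x y wx wy (f.σ-inj _ _ tt tt eq)
  ; τ-inj    = λ F F' gF gF' eq → e.τ-inj F F' gF gF' (f.τ-inj _ _ _ _ eq)
  ; adj-pres = λ x y wx wy → trans (e.adj-pres x y wx wy) (f.adj-pres _ _ tt tt)
  ; inc-pres = λ F x gF wx → trans (e.inc-pres F x gF wx) (f.inc-pres _ _ _ tt)
  }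
  where
  module e = GenEmb e
  module f = GenEmb f
  τ-generated : ∀ F (gF : T (genFat h W F)) → T (genFat g (λ _ → true) (e.τ F gF))
  τ-generated F gF with to T-anyB gF
  ... | x , wx∧Fx with to T-∧ wx∧Fx
  ...   | wx , Fx = from T-anyB (e.σ x wx , subst T (e.inc-pres F x gF wx) Fx)

module _ {s t} {h : Hoffman s} {W : Fin s → Bool} {m : Hoffman t} (e : GenEmb h W m) where
  open GenEmb e

  generated : ∀ {F x} → T (W x) → T (inc h F x) → T (genFat h W F)
  generated {x = x} wx Fx = from T-anyB (x , from T-∧ (wx , Fx))

  GenEmb-fatDegree-≤ : ∀ {x} → T (W x) → fatDegree h x ≤ fat m
  GenEmb-fatDegree-≤ wx = subst (_ ≤_) (count-true (fat m)) (count-mono-injection _ _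
    (λ F Fx → τ F (generated wx Fx)) (λ _ _ → tt) (λ F F' _ _ → τ-inj F F' _ _))

  GenEmb-sharedFat : (∀ F' y' → T (inc m F' y')) →
    ∀ {F x y} → T (W x) → T (W y) → T (inc h F x) → T (inc h F y)
  GenEmb-sharedFat complete {F} {y = y} wx wy Fx =
    subst T (sym (inc-pres F y (generated wx Fx) wy)) (complete _ _)

Fin1-irrelevant : (a b : Fin 1) → a ≡ b
Fin1-irrelevant zero zero = refl

Fin2-pigeonhole : (a b c : Fin 2) → a ≡ b ⊎ a ≡ c ⊎ b ≡ c
Fin2-pigeonhole zero       zero       _          = inj₁ refl
Fin2-pigeonhole (suc zero) (suc zero) _          = inj₁ refl
Fin2-pigeonhole zero       (suc zero) zero       = inj₂ (inj₁ refl)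
Fin2-pigeonhole zero       (suc zero) (suc zero) = inj₂ (inj₂ refl)
Fin2-pigeonhole (suc zero) zero       zero       = inj₂ (inj₂ refl)
Fin2-pigeonhole (suc zero) zero       (suc zero) = inj₂ (inj₁ refl)

GenEmb-h3-subsingleton : ∀ {s} {h : Hoffman s} {W} → GenEmb h W h3 → ∀ {x y} → T (W x) → T (W y) → x ≡ y
GenEmb-h3-subsingleton e wx wy = GenEmb.σ-inj e _ _ wx wy (Fin1-irrelevant _ _)

module _ {s} {h : Hoffman s} {W : Fin s → Bool} (e : GenEmb h W 𝔡) where
  open GenEmb e

  GenEmb-𝔡-adjacent : ∀ {x y} → T (W x) → T (W y) → x ≢ y → adj (slim h) x y ≡ true
  GenEmb-𝔡-adjacent {x} {y} wx wy x≢y with σ x wx ≟ᶠ σ y wy | adj-pres x y wx wy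
  ... | yes σx≡σy | _                 = contradiction (σ-inj x y wx wy σx≡σy) x≢y
  ... | no _      | adj≡distinctIn𝔡 = adj≡distinctIn𝔡

  GenEmb-𝔡-atMostTwo : ∀ {x y z} → T (W x) → T (W y) → T (W z) → x ≡ y ⊎ x ≡ z ⊎ y ≡ z
  GenEmb-𝔡-atMostTwo {x} {y} {z} wx wy wz with Fin2-pigeonhole (σ x wx) (σ y wy) (σ z wz)
  ... | inj₁ eq        = inj₁ (σ-inj x y wx wy eq)
  ... | inj₂ (inj₁ eq) = inj₂ (inj₁ (σ-inj x z wx wz eq))
  ... | inj₂ (inj₂ eq) = inj₂ (inj₂ (σ-inj y z wy wz eq))

record H3D-Decomposition {n} (h : Hoffman n) : Set where
  field
    k               : ℕ
    partOf          : Fin n → Fin k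
    isDecomposition : IsDecomposition h partOf
    fatDegree-2⊎3   : ∀ x → fatDegree h x ≡ 2 ⊎ fatDegree h x ≡ 3
    partners        : ∀ u v → u ≢ v → partOf u ≡ partOf v →
                      adj (slim h) u v ≡ true × fatDegree h u ≡ 2 × (∀ F → inc h F u ≡ inc h F v)
    atMostTwo       : ∀ x y z → partOf x ≡ partOf z → partOf y ≡ partOf z → x ≡ y ⊎ x ≡ z ⊎ y ≡ z

2≤n≤3⇒n≡2⊎n≡3 : ∀ {n} → 2 ≤ n → n ≤ 3 → n ≡ 2 ⊎ n ≡ 3
2≤n≤3⇒n≡2⊎n≡3 (s≤s (s≤s z≤n)) (s≤s (s≤s z≤n))       = inj₁ refl
2≤n≤3⇒n≡2⊎n≡3 (s≤s (s≤s z≤n)) (s≤s (s≤s (s≤s z≤n))) = inj₂ refl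

H3D-line⇒decomposition : ∀ {n} {h : Hoffman n} → IsFat 2 h → (L : IsLine H3D h) →
  H3D-Decomposition (Extension.hoff (proj₁ L))
H3D-line⇒decomposition {n} {h} fat₂ (E , k , p , dec , D) = record
  { k               = k
  ; partOf          = p
  ; isDecomposition = dec
  ; fatDegree-2⊎3   = λ x → 2≤n≤3⇒n≡2⊎n≡3 (fatDegree-≥2 x) (fatDegree-≤3 x)
  ; partners        = partners
  ; atMostTwo       = atMostTwo
  }
  where
  h′ = Extension.hoff E

  model : ∀ i → GenEmb h′ (part p i) h3 ⊎ GenEmb h′ (part p i) 𝔡
  model i with D i
  ... | _ , _ , inj₁ (g↪h3 , _) , e = inj₁ (GenEmb-∘ e g↪h3)
  ... | _ , _ , inj₂ (g↪𝔡 , _) , e = inj₂ (GenEmb-∘ e g↪𝔡)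

  ∈part : ∀ {x i} → p x ≡ i → T (part p i x)
  ∈part = fromWitness

  fatDegree-≥2 : ∀ x → 2 ≤ fatDegree h′ x
  fatDegree-≥2 x = ℕᴾ.≤-trans (fat₂ x) (fatDegree-≤-extension E x)

  fatDegree-≤3 : ∀ x → fatDegree h′ x ≤ 3
  fatDegree-≤3 x with model (p x)
  ... | inj₁ e = GenEmb-fatDegree-≤ e (∈part refl)
  ... | inj₂ e = ℕᴾ.m≤n⇒m≤1+n (GenEmb-fatDegree-≤ e (∈part refl))

  partners : ∀ u v → u ≢ v → p u ≡ p v →
    adj (slim h′) u v ≡ true × fatDegree h′ u ≡ 2 × (∀ F → inc h′ F u ≡ inc h′ F v)
  partners u v u≢v pu≡pv with model (p v)
  ... | inj₁ e = contradiction (GenEmb-h3-subsingleton e (∈part pu≡pv) (∈part refl)) u≢v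
  ... | inj₂ e = GenEmb-𝔡-adjacent e wu wv u≢v
               , ℕᴾ.≤-antisym (GenEmb-fatDegree-≤ e wu) (fatDegree-≥2 u)
               , λ F → T-injective (GenEmb-sharedFat e (λ _ _ → tt) wu wv) (GenEmb-sharedFat e (λ _ _ → tt) wv wu)
    where
    wu = ∈part pu≡pv
    wv = ∈part refl

  atMostTwo : ∀ x y z → p x ≡ p z → p y ≡ p z → x ≡ y ⊎ x ≡ z ⊎ y ≡ z
  atMostTwo x y z px≡pz py≡pz with model (p z)
  ... | inj₁ e = inj₁ (GenEmb-h3-subsingleton e (∈part px≡pz) (∈part py≡pz))
  ... | inj₂ e = GenEmb-𝔡-atMostTwo e (∈part px≡pz) (∈part py≡pz) (∈part refl)

𝟙 : Bool → ℤ
𝟙 b = if b then 1ℤ else 0ℤ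

𝟙-∧ : ∀ a b → 𝟙 a ℤ.* 𝟙 b ≡ 𝟙 (a ∧ b)
𝟙-∧ true  true  = refl
𝟙-∧ true  false = refl
𝟙-∧ false _     = refl

sumℤ-cong : ∀ {a} {f g : Fin a → ℤ} → (∀ i → f i ≡ g i) → sumℤ f ≡ sumℤ g
sumℤ-cong {zero}  f≡g = refl
sumℤ-cong {suc a} f≡g = cong₂ ℤ._+_ (f≡g zero) (sumℤ-cong (f≡g ∘ suc))

sumℤ-𝟙 : ∀ {a} (P : Fin a → Bool) → sumℤ (𝟙 ∘ P) ≡ + count P
sumℤ-𝟙 {zero}  P = refl
sumℤ-𝟙 {suc a} P with P zero
... | true  = cong (λ s → 1ℤ ℤ.+ s) (sumℤ-𝟙 (P ∘ suc))
... | false = trans (ℤᴾ.+-identityˡ _) (sumℤ-𝟙 (P ∘ suc))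

sumℤ-zero : ∀ {a} (f : Fin a → ℤ) → (∀ j → f j ≡ 0ℤ) → sumℤ f ≡ 0ℤ
sumℤ-zero {zero}  f f≡0 = refl
sumℤ-zero {suc a} f f≡0 = cong₂ ℤ._+_ (f≡0 zero) (sumℤ-zero (f ∘ suc) (f≡0 ∘ suc))

sumℤ-single : ∀ {a} (f : Fin a → ℤ) i → (∀ j → j ≢ i → f j ≡ 0ℤ) → sumℤ f ≡ f i
sumℤ-single {suc a} f zero    f≡0 =
  trans (cong (λ s → f zero ℤ.+ s) (sumℤ-zero (f ∘ suc) (λ j → f≡0 (suc j) λ ()))) (ℤᴾ.+-identityʳ (f zero))
sumℤ-single {suc a} f (suc i) f≡0 =
  trans (cong (ℤ._+ sumℤ (f ∘ suc)) (f≡0 zero λ ()))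
        (trans (ℤᴾ.+-identityˡ _) (sumℤ-single (f ∘ suc) i (λ j j≢i → f≡0 (suc j) (j≢i ∘ suc-injective))))

++-suc : ∀ {a b} {A : Set} (f : Fin (suc a) → A) (g : Fin b → A) i → (f ++ g) (suc i) ≡ ((f ∘ suc) ++ g) i
++-suc {a} f g i with splitAt a i
... | inj₁ _ = refl
... | inj₂ _ = refl

sumℤ-++ : ∀ {a b} {A : Set} (φ : A → ℤ) (f : Fin a → A) (g : Fin b → A) →
  sumℤ (φ ∘ (f ++ g)) ≡ sumℤ (φ ∘ f) ℤ.+ sumℤ (φ ∘ g)
sumℤ-++ {zero}  φ f g = sym (ℤᴾ.+-identityˡ _)
sumℤ-++ {suc a} φ f g = begin
  φ (f zero) ℤ.+ sumℤ (φ ∘ (f ++ g) ∘ suc)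
    ≡⟨ cong (λ s → φ (f zero) ℤ.+ s) (sumℤ-cong (cong φ ∘ ++-suc f g)) ⟩
  φ (f zero) ℤ.+ sumℤ (φ ∘ ((f ∘ suc) ++ g))
    ≡⟨ cong (λ s → φ (f zero) ℤ.+ s) (sumℤ-++ φ (f ∘ suc) g) ⟩
  φ (f zero) ℤ.+ (sumℤ (φ ∘ f ∘ suc) ℤ.+ sumℤ (φ ∘ g))
    ≡⟨ sym (ℤᴾ.+-assoc (φ (f zero)) _ _) ⟩
  sumℤ (φ ∘ f) ℤ.+ sumℤ (φ ∘ g) ∎
  where open ≡-Reasoning

module SignedIncidence {n} {h : Hoffman n} (D : H3D-Decomposition h) where

  open H3D-Decomposition D

  HasEarlierPartner : Fin n → Set
  HasEarlierPartner v = ∃ λ w → partOf w ≡ partOf v × w < v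

  hasEarlierPartner? : ∀ v → Dec (HasEarlierPartner v)
  hasEarlierPartner? v = any? (λ w → partOf w ≟ᶠ partOf v ×-dec w <? v)

  sign : Fin n → ℤ
  sign v = if ⌊ hasEarlierPartner? v ⌋ then -1ℤ else 1ℤ

  sign-earlier : ∀ {v} → HasEarlierPartner v → sign v ≡ -1ℤ
  sign-earlier {v} e with hasEarlierPartner? v
  ... | yes _ = refl
  ... | no ¬e = contradiction e ¬e

  sign-first : ∀ {v} → ¬ HasEarlierPartner v → sign v ≡ 1ℤ
  sign-first {v} ¬e with hasEarlierPartner? v
  ... | yes e = contradiction e ¬e
  ... | no _  = refl

  sign≢0 : ∀ v → sign v ≢ 0ℤ
  sign≢0 v with hasEarlierPartner? v
  ... | yes _ = λ ()
  ... | no _  = λ ()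

  sign-±1 : ∀ v → sign v ≡ 1ℤ ⊎ sign v ≡ -1ℤ
  sign-±1 v with hasEarlierPartner? v
  ... | yes _ = inj₂ refl
  ... | no _  = inj₁ refl

  sign² : ∀ v → sign v ℤ.* sign v ≡ 1ℤ
  sign² v with hasEarlierPartner? v
  ... | yes _ = refl
  ... | no _  = refl

  first-of-pair : ∀ {u v} → u < v → partOf u ≡ partOf v → ¬ HasEarlierPartner u
  first-of-pair {u} {v} u<v pu≡pv (w , pw≡pu , w<u) with atMostTwo w u v (trans pw≡pu pu≡pv) pu≡pv
  ... | inj₁ w≡u        = <⇒≢ w<u w≡u
  ... | inj₂ (inj₁ w≡v) = <⇒≢ (<-trans w<u u<v) w≡v
  ... | inj₂ (inj₂ u≡v) = <⇒≢ u<v u≡v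

  sign-opposite : ∀ {u v} → u ≢ v → partOf u ≡ partOf v → sign u ℤ.* sign v ≡ -1ℤ
  sign-opposite {u} {v} u≢v pu≡pv with <-cmp u v
  ... | tri< u<v _ _ = cong₂ ℤ._*_ (sign-first (first-of-pair u<v pu≡pv)) (sign-earlier (u , pu≡pv , u<v))
  ... | tri≈ _ u≡v _ = contradiction u≡v u≢v
  ... | tri> _ _ v<u = cong₂ ℤ._*_ (sign-earlier (v , sym pu≡pv , v<u)) (sign-first (first-of-pair v<u (sym pu≡pv)))

  partEntry : Fin n → ℤ
  partEntry v with fatDegree-2⊎3 v
  ... | inj₁ _ = sign v
  ... | inj₂ _ = 0ℤ

  partEntry-2 : ∀ {v} → fatDegree h v ≡ 2 → partEntry v ≡ sign v
  partEntry-2 {v} d₂ with fatDegree-2⊎3 v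
  ... | inj₁ _  = refl
  ... | inj₂ d₃ = contradiction (trans (sym d₂) d₃) λ ()

  column-norm : ∀ v → + fatDegree h v ℤ.+ partEntry v ℤ.* partEntry v ≡ + 3
  column-norm v with fatDegree-2⊎3 v
  ... | inj₁ d₂ rewrite d₂ = cong (λ s → + 2 ℤ.+ s) (sign² v)
  ... | inj₂ d₃ rewrite d₃ = refl

  column-sum : ∀ v → (+ fatDegree h v ℤ.+ partEntry v ≡ + 3)
                   ⊎ (+ fatDegree h v ℤ.+ partEntry v ≡ 1ℤ × HasEarlierPartner v)
  column-sum v with fatDegree-2⊎3 v
  ... | inj₂ d₃ rewrite d₃ = inj₁ refl
  ... | inj₁ d₂ rewrite d₂ with hasEarlierPartner? v
  ...   | yes e = inj₂ (refl , e)
  ...   | no _  = inj₁ refl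

  partners-fatDegree : ∀ {u v} → u ≢ v → partOf u ≡ partOf v → fatDegree h v ≡ 2
  partners-fatDegree {u} {v} u≢v pu≡pv =
    let _ , d₂ , same = partners u v u≢v pu≡pv in trans (sym (count-cong same)) d₂

  fatRows : Fin (fat h) → Fin n → ℤ
  fatRows F v = 𝟙 (inc h F v)

  partRows : Fin k → Fin n → ℤ
  partRows j v = if ⌊ partOf v ≟ᶠ j ⌋ then partEntry v else 0ℤ

  partRows-in : ∀ {j v} → partOf v ≡ j → partRows j v ≡ partEntry v
  partRows-in {j} {v} pv≡j with partOf v ≟ᶠ j
  ... | yes _     = refl
  ... | no pv≢j   = contradiction pv≡j pv≢j

  partRows-out : ∀ {j v} → partOf v ≢ j → partRows j v ≡ 0ℤ
  partRows-out {j} {v} pv≢j with partOf v ≟ᶠ j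
  ... | yes pv≡j = contradiction pv≡j pv≢j
  ... | no _     = refl

  N : Fin (fat h ℕ.+ k) → Fin n → ℤ
  N = fatRows ++ partRows

  N-dot : ∀ u v → sumℤ (λ i → N i u ℤ.* N i v) ≡ + commonFat h u v ℤ.+ partEntry u ℤ.* partRows (partOf u) v
  N-dot u v = begin
    sumℤ (λ i → N i u ℤ.* N i v)
      ≡⟨ sumℤ-++ (λ r → r u ℤ.* r v) fatRows partRows ⟩
    sumℤ (λ F → fatRows F u ℤ.* fatRows F v) ℤ.+ sumℤ (λ j → partRows j u ℤ.* partRows j v)
      ≡⟨ cong₂ ℤ._+_ (trans (sumℤ-cong (λ F → 𝟙-∧ (inc h F u) (inc h F v))) (sumℤ-𝟙 (λ F → inc h F u ∧ inc h F v)))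
                     (sumℤ-single (λ j → partRows j u ℤ.* partRows j v) (partOf u) (λ j j≢pu → cong (ℤ._* partRows j v) (partRows-out (j≢pu ∘ sym)))) ⟩
    + commonFat h u v ℤ.+ partRows (partOf u) u ℤ.* partRows (partOf u) v
      ≡⟨ cong (λ e → + commonFat h u v ℤ.+ e ℤ.* partRows (partOf u) v) (partRows-in refl) ⟩
    + commonFat h u v ℤ.+ partEntry u ℤ.* partRows (partOf u) v ∎
    where open ≡-Reasoning

  N-columnSum : ∀ v → sumℤ (λ i → N i v) ≡ + fatDegree h v ℤ.+ partEntry v
  N-columnSum v = begin
    sumℤ (λ i → N i v)
      ≡⟨ sumℤ-++ (λ r → r v) fatRows partRows ⟩
    sumℤ (λ F → fatRows F v) ℤ.+ sumℤ (λ j → partRows j v)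
      ≡⟨ cong₂ ℤ._+_ (sumℤ-𝟙 (λ F → inc h F v)) (sumℤ-single (λ j → partRows j v) (partOf v) (λ j j≢pv → partRows-out (j≢pv ∘ sym))) ⟩
    + fatDegree h v ℤ.+ partRows (partOf v) v
      ≡⟨ cong (λ e → + fatDegree h v ℤ.+ e) (partRows-in refl) ⟩
    + fatDegree h v ℤ.+ partEntry v ∎
    where open ≡-Reasoning

  δ-diag : ∀ (u : Fin n) → δ u u ≡ 1ℤ
  δ-diag u with u ≟ᶠ u
  ... | yes _   = refl
  ... | no u≢u  = contradiction refl u≢u

  δ-off : ∀ {u v : Fin n} → u ≢ v → δ u v ≡ 0ℤ
  δ-off {u} {v} u≢v with u ≟ᶠ v
  ... | yes u≡v = contradiction u≡v u≢v
  ... | no _    = refl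

  N-gram : ∀ u v → A (slim h) u v ℤ.+ + 3 ℤ.* δ u v ≡ sumℤ (λ i → N i u ℤ.* N i v)
  N-gram u v = sym (trans (N-dot u v) (entry u v (u ≟ᶠ v) (partOf u ≟ᶠ partOf v)))
    where
    open ≡-Reasoning
    entry : ∀ u v → Dec (u ≡ v) → Dec (partOf u ≡ partOf v) →
      + commonFat h u v ℤ.+ partEntry u ℤ.* partRows (partOf u) v ≡ A (slim h) u v ℤ.+ + 3 ℤ.* δ u v
    entry u .u (yes refl) _ = begin
      + commonFat h u u ℤ.+ partEntry u ℤ.* partRows (partOf u) u
        ≡⟨ cong₂ (λ c e → + c ℤ.+ partEntry u ℤ.* e) (count-cong (λ F → ∧-idem (inc h F u))) (partRows-in refl) ⟩
      + fatDegree h u ℤ.+ partEntry u ℤ.* partEntry u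
        ≡⟨ column-norm u ⟩
      + 3
        ≡⟨ sym (cong₂ (λ a d → a ℤ.+ + 3 ℤ.* d) (cong 𝟙 (irrefl (slim h) u)) (δ-diag u)) ⟩
      A (slim h) u u ℤ.+ + 3 ℤ.* δ u u ∎
    entry u v (no u≢v) (yes pu≡pv) with partners u v u≢v pu≡pv
    ... | adjacent , d₂ , same = begin
      + commonFat h u v ℤ.+ partEntry u ℤ.* partRows (partOf u) v
        ≡⟨ cong₂ (λ c e → + c ℤ.+ e) common≡2 entries≡-1 ⟩
      1ℤ
        ≡⟨ sym (cong₂ (λ a d → a ℤ.+ + 3 ℤ.* d) (cong 𝟙 adjacent) (δ-off u≢v)) ⟩
      A (slim h) u v ℤ.+ + 3 ℤ.* δ u v ∎
      where
      common≡2 : commonFat h u v ≡ 2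
      common≡2 = trans (count-cong (λ F → trans (cong (inc h F u ∧_) (sym (same F))) (∧-idem _))) d₂
      entries≡-1 : partEntry u ℤ.* partRows (partOf u) v ≡ -1ℤ
      entries≡-1 = trans (cong₂ ℤ._*_ (partEntry-2 d₂)
                                     (trans (partRows-in (sym pu≡pv)) (partEntry-2 (partners-fatDegree u≢v pu≡pv))))
                         (sign-opposite u≢v pu≡pv)
    entry u v (no u≢v) (no pu≢pv) = begin
      + commonFat h u v ℤ.+ partEntry u ℤ.* partRows (partOf u) v
        ≡⟨ cong (λ e → + commonFat h u v ℤ.+ partEntry u ℤ.* e) (partRows-out (pu≢pv ∘ sym)) ⟩
      + commonFat h u v ℤ.+ partEntry u ℤ.* 0ℤ
        ≡⟨ cong (λ e → + commonFat h u v ℤ.+ e) (ℤᴾ.*-zeroʳ (partEntry u)) ⟩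
      + commonFat h u v ℤ.+ 0ℤ
        ≡⟨ sym (cong₂ (λ a d → a ℤ.+ + 3 ℤ.* d) (ℤᴾ.i-j≡0⇒i≡j (A (slim h) u v) (+ commonFat h u v) (isDecomposition u v pu≢pv)) (δ-off u≢v)) ⟩
      A (slim h) u v ℤ.+ + 3 ℤ.* δ u v ∎

  Is0±1 : ℤ → Set
  Is0±1 z = z ≡ 0ℤ ⊎ z ≡ 1ℤ ⊎ z ≡ -1ℤ

  N-entries : ∀ i v → Is0±1 (N i v)
  N-entries = ++⁺ (λ r → ∀ v → Is0±1 (r v)) {xs = fatRows} {ys = partRows} fatRows-0±1 partRows-0±1
    where
    fatRows-0±1 : ∀ F v → Is0±1 (fatRows F v)
    fatRows-0±1 F v with inc h F v
    ... | true  = inj₂ (inj₁ refl)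
    ... | false = inj₁ refl
    partEntry-0±1 : ∀ v → Is0±1 (partEntry v)
    partEntry-0±1 v with fatDegree-2⊎3 v
    ... | inj₂ _ = inj₁ refl
    ... | inj₁ _ = inj₂ (sign-±1 v)
    partRows-0±1 : ∀ j v → Is0±1 (partRows j v)
    partRows-0±1 j v with partOf v ≟ᶠ j
    ... | yes _ = partEntry-0±1 v
    ... | no _  = inj₁ refl

  N-norm : ∀ v → sumℤ (λ i → N i v ℤ.* N i v) ≡ + 3
  N-norm v = trans (sym (N-gram v v)) (cong₂ (λ a d → a ℤ.+ + 3 ℤ.* d) (cong 𝟙 (irrefl (slim h) v)) (δ-diag v))

  N-columnSum-1⊎3 : ∀ v → sumℤ (λ i → N i v) ≡ 1ℤ ⊎ sumℤ (λ i → N i v) ≡ + 3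
  N-columnSum-1⊎3 v with column-sum v
  ... | inj₁ Σ≡3       = inj₂ (trans (N-columnSum v) Σ≡3)
  ... | inj₂ (Σ≡1 , _) = inj₁ (trans (N-columnSum v) Σ≡1)

  SameSupport : ℤ → ℤ → Set
  SameSupport a b = (a ≡ 0ℤ → b ≡ 0ℤ) × (b ≡ 0ℤ → a ≡ 0ℤ)

  N-partner : ∀ v → sumℤ (λ i → N i v) ≡ 1ℤ →
    ∃ λ u → sumℤ (λ i → N i v ℤ.* N i u) ≡ 1ℤ × (∀ i → SameSupport (N i v) (N i u))
  N-partner v Σ≡1 with column-sum v
  ... | inj₁ Σ≡3 = contradiction (trans (sym Σ≡1) (trans (N-columnSum v) Σ≡3)) λ ()
  ... | inj₂ (_ , w , pw≡pv , w<v) with partners v w (<⇒≢ w<v ∘ sym) (sym pw≡pv)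
  ...   | adjacent , d₂ , same =
    w , dot≡1 , ++⁺ (λ r → SameSupport (r v) (r w)) {xs = fatRows} {ys = partRows} fatRows-same partRows-same
    where
    v≢w : v ≢ w
    v≢w = <⇒≢ w<v ∘ sym
    dot≡1 : sumℤ (λ i → N i v ℤ.* N i w) ≡ 1ℤ
    dot≡1 = trans (sym (N-gram v w)) (cong₂ (λ a d → a ℤ.+ + 3 ℤ.* d) (cong 𝟙 adjacent) (δ-off v≢w))
    fatRows-same : ∀ F → SameSupport (fatRows F v) (fatRows F w)
    fatRows-same F rewrite same F = id , id
    nonzero : ∀ {x j} → partOf x ≡ j → fatDegree h x ≡ 2 → partRows j x ≢ 0ℤ
    nonzero {x} px≡j d₂ = sign≢0 x ∘ trans (sym (trans (partRows-in px≡j) (partEntry-2 d₂)))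
    partRows-same : ∀ j → SameSupport (partRows j v) (partRows j w)
    partRows-same j = bySide (partOf v ≟ᶠ j)
      where
      bySide : Dec (partOf v ≡ j) → SameSupport (partRows j v) (partRows j w)
      bySide (yes pv≡j) = (λ z → contradiction z (nonzero pv≡j d₂))
                        , (λ z → contradiction z (nonzero (trans pw≡pv pv≡j) (partners-fatDegree v≢w (sym pw≡pv))))
      bySide (no pv≢j)  = (λ _ → partRows-out (pv≢j ∘ trans (sym pw≡pv))) , (λ _ → partRows-out pv≢j)

open import Data.Integer using (_+_; _*_)

proposition3p2 : (n c q : ℕ) → 1 ≤ c → 1 ≤ q → (G : Graph n) → MuBounded G c →
    (h : Hoffman n) → IsAssociated G q h → IsFat 2 h → IsLine H3D h →
    Σ ℕ λ m → Σ (Fin m → Fin n → ℤ) λ N →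
      (∀ i v → N i v ≡ 0ℤ ⊎ N i v ≡ 1ℤ ⊎ N i v ≡ -1ℤ) ×
      (∀ u v → A G u v + (+ 3) * δ u v ≡ sumℤ (λ i → N i u * N i v)) ×
      (∀ (x : Fin n → ℚ) → 0ℚ ℚ.≤ sumℚ (λ u → sumℚ (λ v →
         x u ℚ.* ((ℚ._/_ (A G u v + (+ 3) * δ u v) 1) ℚ.* x v)))) ×
      (∀ v → sumℤ (λ i → N i v * N i v) ≡ + 3) ×
      (∀ v → sumℤ (λ i → N i v) ≡ 1ℤ ⊎ sumℤ (λ i → N i v) ≡ + 3) ×
      (∀ v → sumℤ (λ i → N i v) ≡ 1ℤ →
         ∃ λ u → sumℤ (λ i → N i v * N i u) ≡ 1ℤ ×
           (∀ i → (N i v ≡ 0ℤ → N i u ≡ 0ℤ) × (N i u ≡ 0ℤ → N i v ≡ 0ℤ)))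
proposition3p2 _ _ _ _ _ G _ _ (slim≡G , _) fat₂ line =
  _ , N , N-entries , gramG , gram⇒positiveSemidefinite N _ gramG , N-norm , N-columnSum-1⊎3 , N-partner
  where
  open SignedIncidence (H3D-line⇒decomposition fat₂ line)
  gramG : ∀ u v → A G u v + + 3 * δ u v ≡ sumℤ (λ i → N i u * N i v)
  gramG u v = trans (cong (λ a → 𝟙 a + + 3 * δ u v) (sym (slim≡G u v))) (N-gram u v)
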